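{- Let $k \geq 1$ and $k+2 \leq n \leq 2k$. Then the biclique-chromatic number of the power of a path $P_n^k$ is $2k+2-n$.
   Context: For $k \geq 1$, the power of a path $P_n^k$ is the simple graph with vertex set $\{v_0,\dots,v_{n-1}\}$ in which $v_i v_j$ is an edge if and only if $0<|i-j| \leq k$. A biclique of a graph is a maximal (under inclusion) set of vertices inducing a complete bipartite subgraph with at least one edge. A biclique-colouring is an assignment of colours to the vertices such that no biclique is monochromatic; the biclique-chromatic number $\kappa_B(G)$ is the least $c$ such that $G$ has a biclique-colouring using at most $c$ colours. -}

module Defs where

open import Data.Nat using (ℕ; _≤_; _<_; ∣_-_∣)
open import Data.Fin using (Fin; toℕ)
open import Data.Fin.Subset using (Subset; _∈_; _⊆_; Nonempty)
open import Data.Product using (Σ; ∃; ∃-syntax; _×_; _,_)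
open import Data.Sum using (_⊎_)
open import Data.Empty using (⊥)
open import Relation.Nullary using (¬_)
open import Relation.Binary.PropositionalEquality using (_≡_; _≢_)

PathPowerAdj : (n k : ℕ) → Fin n → Fin n → Set
PathPowerAdj n k i j = (0 < ∣ toℕ i - toℕ j ∣) × (∣ toℕ i - toℕ j ∣ ≤ k)

InducesBiclique : (n k : ℕ) → Subset n → Set
InducesBiclique n k S =
  ∃[ A ] ∃[ B ]
    ( A ⊆ S × B ⊆ S
    × (∀ x → x ∈ S → x ∈ A ⊎ x ∈ B)
    × (∀ x → x ∈ A → x ∈ B → ⊥)
    × Nonempty A × Nonempty B
    × (∀ a b → a ∈ A → b ∈ B → PathPowerAdj n k a b)
    × (∀ a a′ → a ∈ A → a′ ∈ A → ¬ PathPowerAdj n k a a′)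
    × (∀ b b′ → b ∈ B → b′ ∈ B → ¬ PathPowerAdj n k b b′) )

IsBiclique : (n k : ℕ) → Subset n → Set
IsBiclique n k S =
  InducesBiclique n k S × (∀ T → S ⊆ T → InducesBiclique n k T → T ⊆ S)

IsBicliqueColouring : (n k c : ℕ) → (Fin n → Fin c) → Set
IsBicliqueColouring n k c col =
  ∀ S → IsBiclique n k S → ∃[ u ] ∃[ v ] (u ∈ S × v ∈ S × col u ≢ col v)

BicliqueColourable : (n k c : ℕ) → Set
BicliqueColourable n k c = Σ (Fin n → Fin c) (IsBicliqueColouring n k c)

BicliqueChromaticNumber≡ : (n k c : ℕ) → Set
BicliqueChromaticNumber≡ n k c =
  BicliqueColourable n k c × (∀ m → m < c → ¬ BicliqueColourable n k m)

-- Write n = a + k + 1, so 1 ≤ a < k, and split the vertices of P_n^k into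
-- Low = {v_i : i < a}, Middle = {v_i : a ≤ i ≤ k} and High = {v_i : k < i}.
-- The k + 1 − a = 2k + 2 − n middle vertices are universal, and Low and High are
-- cliques. Any two universal vertices form a biclique on their own, so a
-- biclique-colouring must give them distinct colours. Conversely, colour
-- Low with the colour of v_a, High with the colour of v_k, and the middle
-- vertices injectively. A biclique meeting both Low and High is then
-- bichromatic; a biclique avoiding High cannot meet the clique Low either,
-- since a suitable vertex of High could always be added to it, so it
-- consists of at least two middle vertices (and symmetrically).
module Submission where

open import Defs
open import Data.Nat using (ℕ; suc; _≤_; _<_; _+_; _*_; _∸_; _⊓_; ∣_-_∣; z≤n; s≤s; s≤s⁻¹; _<?_; _≤?_)
open import Data.Nat.Properties
open import Data.Nat.Tactic.RingSolver using (solve-∀)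
open import Data.Fin using (Fin; toℕ; fromℕ<)
import Data.Fin.Properties as Fin
open import Data.Fin.Subset using (Subset; _∈_; _⊆_; Nonempty; ⁅_⁆; _∪_)
open import Data.Fin.Subset.Properties using (x∈⁅x⁆; x∈⁅y⁆⇒x≡y; x∈p∪q⁺; x∈p∪q⁻; _∈?_)
open import Data.Product using (∃; ∃₂; _×_; _,_; proj₁; proj₂)
open import Data.Sum using (_⊎_; inj₁; inj₂; [_,_]′)
import Data.Sum as Sum
open import Data.Empty using (⊥; ⊥-elim)
open import Function using (_∘_)
open import Relation.Nullary using (¬_; yes; no; contradiction; _×-dec_)
open import Relation.Unary using (Decidable)
open import Relation.Binary using (tri<; tri≈; tri>)
open import Relation.Binary.PropositionalEquality

module PathPower (n k : ℕ) where

  -- PathPowerAdj n k i j unfolds to Near (toℕ i) (toℕ j), so facts about Near are facts about Adj.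
  Near : ℕ → ℕ → Set
  Near m p = (0 < ∣ m - p ∣) × (∣ m - p ∣ ≤ k)

  Adj : Fin n → Fin n → Set
  Adj = PathPowerAdj n k

  near-sym : ∀ m p → Near m p → Near p m
  near-sym m p m~p rewrite ∣-∣-comm p m = m~p

  adj-sym : ∀ i j → Adj i j → Adj j i
  adj-sym i j = near-sym (toℕ i) (toℕ j)

  adj-irrefl : ∀ i → ¬ Adj i i
  adj-irrefl i (p , _) rewrite ∣n-n∣≡0 (toℕ i) = <-irrefl refl p

  near : ∀ {m p} → m ≢ p → m ≤ p + k → p ≤ m + k → Near m p
  near {m} {p} m≢p m≤p+k p≤m+k =
    n≢0⇒n>0 (m≢p ∘ ∣m-n∣≡0⇒m≡n) ,
    [ distance≤ m≤p+k , distance≤ p≤m+k ]′ (∣m-n∣≡[m∸n]∨[n∸m] m p)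
    where
    distance≤ : ∀ {i j} → i ≤ j + k → ∣ m - p ∣ ≡ i ∸ j → ∣ m - p ∣ ≤ k
    distance≤ {i} {j} i≤j+k eq = subst (_≤ k) (sym eq) (m≤n+o⇒m∸n≤o i j i≤j+k)

  not-near : ∀ {m p} → m + k < p → ¬ Near m p
  not-near {m} {p} m+k<p (_ , d≤k) = <⇒≱ m+k<p (≤-trans (m≤n+∣n-m∣ p m) (+-monoʳ-≤ m d≤k))

  record CompleteBipartition (S A B : Subset n) : Set where
    field
      A⊆S : A ⊆ S
      B⊆S : B ⊆ S
      cover : ∀ x → x ∈ S → x ∈ A ⊎ x ∈ B
      disjoint : ∀ x → x ∈ A → x ∈ B → ⊥
      A-nonempty : Nonempty A
      B-nonempty : Nonempty B
      complete : ∀ a b → a ∈ A → b ∈ B → Adj a b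
      A-independent : ∀ a a′ → a ∈ A → a′ ∈ A → ¬ Adj a a′
      B-independent : ∀ b b′ → b ∈ B → b′ ∈ B → ¬ Adj b b′

  induces : ∀ {S A B} → CompleteBipartition S A B → InducesBiclique n k S
  induces {A = A} {B} S=A+B =
    A , B , A⊆S , B⊆S , cover , disjoint , A-nonempty , B-nonempty , complete , A-independent , B-independent
    where open CompleteBipartition S=A+B

  bipartition : ∀ {S} → InducesBiclique n k S → ∃₂ (CompleteBipartition S)
  bipartition (A , B , A⊆S , B⊆S , cover , disjoint , A≠∅ , B≠∅ , complete , A-ind , B-ind) =
    A , B , record
      { A⊆S = A⊆S ; B⊆S = B⊆S ; cover = cover ; disjoint = disjoint
      ; A-nonempty = A≠∅ ; B-nonempty = B≠∅ ; complete = complete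
      ; A-independent = A-ind ; B-independent = B-ind }

  swap : ∀ {S A B} → CompleteBipartition S A B → CompleteBipartition S B A
  swap S=A+B = record
    { A⊆S = B⊆S ; B⊆S = A⊆S
    ; cover = λ x x∈S → Sum.swap (cover x x∈S)
    ; disjoint = λ x x∈B x∈A → disjoint x x∈A x∈B
    ; A-nonempty = B-nonempty ; B-nonempty = A-nonempty
    ; complete = λ b a b∈B a∈A → adj-sym a b (complete a b a∈A b∈B)
    ; A-independent = B-independent ; B-independent = A-independent }
    where open CompleteBipartition S=A+B

  parts-distinct : ∀ {S A B x z} → CompleteBipartition S A B → x ∈ A → z ∈ B → x ≢ z
  parts-distinct S=A+B x∈A z∈B refl = CompleteBipartition.disjoint S=A+B _ x∈A z∈B

  triangle-free : ∀ {S A B x y z} → CompleteBipartition S A B → x ∈ S → y ∈ S → z ∈ S →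
                  Adj x y → Adj x z → Adj y z → ⊥
  triangle-free {A = A} {B} {x} {y} {z} S=A+B x∈S y∈S z∈S x~y x~z y~z =
    sides (cover x x∈S) (cover y y∈S) (cover z z∈S)
    where
    open CompleteBipartition S=A+B
    sides : x ∈ A ⊎ x ∈ B → y ∈ A ⊎ y ∈ B → z ∈ A ⊎ z ∈ B → ⊥
    sides (inj₁ x∈A) (inj₁ y∈A) _          = A-independent x y x∈A y∈A x~y
    sides (inj₂ x∈B) (inj₂ y∈B) _          = B-independent x y x∈B y∈B x~y
    sides (inj₁ x∈A) (inj₂ _)   (inj₁ z∈A) = A-independent x z x∈A z∈A x~z
    sides (inj₁ _)   (inj₂ y∈B) (inj₂ z∈B) = B-independent y z y∈B z∈B y~z
    sides (inj₂ _)   (inj₁ y∈A) (inj₁ z∈A) = A-independent y z y∈A z∈A y~z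
    sides (inj₂ x∈B) (inj₁ _)   (inj₂ z∈B) = B-independent x z x∈B z∈B x~z

  Maximal : Subset n → Set
  Maximal S = ∀ T → S ⊆ T → InducesBiclique n k T → T ⊆ S

  ∈-∪⁅⁆⁻ : ∀ {x y} (P : Subset n) → x ∈ P ∪ ⁅ y ⁆ → x ∈ P ⊎ x ≡ y
  ∈-∪⁅⁆⁻ {y = y} P = Sum.map₂ (x∈⁅y⁆⇒x≡y y) ∘ x∈p∪q⁻ P ⁅ y ⁆

  y∈-∪⁅y⁆ : ∀ {y} (P : Subset n) → y ∈ P ∪ ⁅ y ⁆
  y∈-∪⁅y⁆ {y} P = x∈p∪q⁺ {p = P} (inj₂ (x∈⁅x⁆ y))

  maximal-absorbs : ∀ {S A B} → CompleteBipartition S A B → Maximal S → ∀ y →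
                    (∀ b → b ∈ B → Adj y b) → (∀ a → a ∈ A → ¬ Adj y a) → y ∈ S
  maximal-absorbs {S} {A} {B} S=A+B maximal y y~B y≁A =
    maximal (S ∪ ⁅ y ⁆) (x∈p∪q⁺ ∘ inj₁) (induces extended) (y∈-∪⁅y⁆ S)
    where
    open CompleteBipartition S=A+B

    A′⊆S′ : A ∪ ⁅ y ⁆ ⊆ S ∪ ⁅ y ⁆
    A′⊆S′ x∈ with ∈-∪⁅⁆⁻ A x∈
    ... | inj₁ x∈A = x∈p∪q⁺ (inj₁ (A⊆S x∈A))
    ... | inj₂ refl = y∈-∪⁅y⁆ S

    cover′ : ∀ x → x ∈ S ∪ ⁅ y ⁆ → x ∈ A ∪ ⁅ y ⁆ ⊎ x ∈ B
    cover′ x x∈ with ∈-∪⁅⁆⁻ S x∈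
    ... | inj₁ x∈S = Sum.map₁ (x∈p∪q⁺ ∘ inj₁) (cover x x∈S)
    ... | inj₂ refl = inj₁ (y∈-∪⁅y⁆ A)

    disjoint′ : ∀ x → x ∈ A ∪ ⁅ y ⁆ → x ∈ B → ⊥
    disjoint′ x x∈ x∈B with ∈-∪⁅⁆⁻ A x∈
    ... | inj₁ x∈A = disjoint x x∈A x∈B
    ... | inj₂ refl = adj-irrefl y (y~B y x∈B)

    complete′ : ∀ a b → a ∈ A ∪ ⁅ y ⁆ → b ∈ B → Adj a b
    complete′ a b a∈ b∈B with ∈-∪⁅⁆⁻ A a∈
    ... | inj₁ a∈A = complete a b a∈A b∈B
    ... | inj₂ refl = y~B b b∈B

    A′-independent : ∀ a a′ → a ∈ A ∪ ⁅ y ⁆ → a′ ∈ A ∪ ⁅ y ⁆ → ¬ Adj a a′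
    A′-independent a a′ a∈ a′∈ with ∈-∪⁅⁆⁻ A a∈ | ∈-∪⁅⁆⁻ A a′∈
    ... | inj₁ a∈A | inj₁ a′∈A = A-independent a a′ a∈A a′∈A
    ... | inj₁ a∈A | inj₂ refl = y≁A a a∈A ∘ adj-sym a y
    ... | inj₂ refl | inj₁ a′∈A = y≁A a′ a′∈A
    ... | inj₂ refl | inj₂ refl = adj-irrefl y

    extended : CompleteBipartition (S ∪ ⁅ y ⁆) (A ∪ ⁅ y ⁆) B
    extended = record
      { A⊆S = A′⊆S′ ; B⊆S = x∈p∪q⁺ ∘ inj₁ ∘ B⊆S ; cover = cover′ ; disjoint = disjoint′
      ; A-nonempty = y , y∈-∪⁅y⁆ A ; B-nonempty = B-nonempty ; complete = complete′
      ; A-independent = A′-independent ; B-independent = B-independent }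

  Universal : Fin n → Set
  Universal u = ∀ x → u ≢ x → Adj u x

  universal-pair-biclique : ∀ {u w} → u ≢ w → Universal u → Universal w → IsBiclique n k (⁅ u ⁆ ∪ ⁅ w ⁆)
  universal-pair-biclique {u} {w} u≢w u-universal w-universal = induces pair , maximal
    where
    u∈ : u ∈ ⁅ u ⁆ ∪ ⁅ w ⁆
    u∈ = x∈p∪q⁺ (inj₁ (x∈⁅x⁆ u))
    w∈ : w ∈ ⁅ u ⁆ ∪ ⁅ w ⁆
    w∈ = y∈-∪⁅y⁆ ⁅ u ⁆

    ≡u : ∀ {x} → x ∈ ⁅ u ⁆ → x ≡ u
    ≡u = x∈⁅y⁆⇒x≡y u
    ≡w : ∀ {x} → x ∈ ⁅ w ⁆ → x ≡ w
    ≡w = x∈⁅y⁆⇒x≡y w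

    pair : CompleteBipartition (⁅ u ⁆ ∪ ⁅ w ⁆) ⁅ u ⁆ ⁅ w ⁆
    pair = record
      { A⊆S = x∈p∪q⁺ ∘ inj₁ ; B⊆S = x∈p∪q⁺ ∘ inj₂
      ; cover = λ x → x∈p∪q⁻ ⁅ u ⁆ ⁅ w ⁆
      ; disjoint = λ x x∈u x∈w → u≢w (trans (sym (≡u x∈u)) (≡w x∈w))
      ; A-nonempty = u , x∈⁅x⁆ u ; B-nonempty = w , x∈⁅x⁆ w
      ; complete = λ a b a∈ b∈ → subst₂ Adj (sym (≡u a∈)) (sym (≡w b∈)) (u-universal w u≢w)
      ; A-independent = λ a a′ a∈ a′∈ → adj-irrefl u ∘ subst₂ Adj (≡u a∈) (≡u a′∈)
      ; B-independent = λ b b′ b∈ b′∈ → adj-irrefl w ∘ subst₂ Adj (≡w b∈) (≡w b′∈) }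

    maximal : Maximal (⁅ u ⁆ ∪ ⁅ w ⁆)
    maximal T pair⊆T T-biclique {x} x∈T with bipartition T-biclique | x Fin.≟ u | x Fin.≟ w
    ... | _ | yes refl | _ = u∈
    ... | _ | no _ | yes refl = w∈
    ... | _ , _ , T=A+B | no x≢u | no x≢w =
      ⊥-elim (triangle-free T=A+B (pair⊆T u∈) (pair⊆T w∈) x∈T
                (u-universal w u≢w) (u-universal x (x≢u ∘ sym)) (w-universal x (x≢w ∘ sym)))

  Separates : (Fin n → Set) → Fin n → Fin n → Set
  Separates O x z = ∃ λ y → O y × Adj y z × ¬ Adj y x

  <-wlog : ∀ {C : Fin n → Set} {R : Fin n → Fin n → Set} →
           (∀ {x z} → C x → C z → toℕ x < toℕ z → R x z) →
           ∀ {x z} → C x → C z → x ≢ z → R x z ⊎ R z x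
  <-wlog ordered {x} {z} x∈C z∈C x≢z with <-cmp (toℕ x) (toℕ z)
  ... | tri< x<z _ _ = inj₁ (ordered x∈C z∈C x<z)
  ... | tri≈ _ x≡z _ = ⊥-elim (x≢z (Fin.toℕ-injective x≡z))
  ... | tri> _ _ z<x = inj₂ (ordered z∈C x∈C z<x)

  module CliqueAndCentre
    (Clique Centre Opposite : Fin n → Set)
    (Clique? : Decidable Clique)
    (trichotomy : ∀ x → Clique x ⊎ Centre x ⊎ Opposite x)
    (centre-universal : ∀ u → Centre u → Universal u)
    (clique : ∀ x z → Clique x → Clique z → x ≢ z → Adj x z)
    (sees-centre-not-clique : ∃ λ y → Opposite y × (∀ u → Centre u → Adj y u) × (∀ x → Clique x → ¬ Adj y x))
    (separating : ∀ {x z} → Clique x → Clique z → x ≢ z → Separates Opposite x z ⊎ Separates Opposite z x)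
    {S : Subset n} (S-biclique : IsBiclique n k S) (S∩Opposite≡∅ : ∀ x → x ∈ S → ¬ Opposite x)
    where

    no-attachment : ∀ {A B} → CompleteBipartition S A B → ∀ y → Opposite y →
                    (∀ b → b ∈ B → Adj y b) → (∀ a → a ∈ A → ¬ Adj y a) → ⊥
    no-attachment S=A+B y opposite y~B y≁A =
      S∩Opposite≡∅ y (maximal-absorbs S=A+B (proj₂ S-biclique) y y~B y≁A) opposite

    non-clique⇒centre : ∀ {x} → x ∈ S → ¬ Clique x → Centre x
    non-clique⇒centre {x} x∈S x∉Clique with trichotomy x
    ... | inj₁ x∈Clique = contradiction x∈Clique x∉Clique
    ... | inj₂ (inj₁ x∈Centre) = x∈Centre
    ... | inj₂ (inj₂ x∈Opposite) = contradiction x∈Opposite (S∩Opposite≡∅ x x∈S)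

    part-is-singleton : ∀ {A B x a} → CompleteBipartition S A B → x ∈ A → Clique x → a ∈ A → a ≡ x
    part-is-singleton {x = x} {a} S=A+B x∈A x∈Clique a∈A with a Fin.≟ x
    ... | yes a≡x = a≡x
    ... | no a≢x = ⊥-elim (A-independent a x a∈A x∈A a~x)
      where
      open CompleteBipartition S=A+B
      a~x : Adj a x
      a~x with trichotomy a
      ... | inj₁ a∈Clique = clique a x a∈Clique x∈Clique a≢x
      ... | inj₂ (inj₁ a∈Centre) = centre-universal a a∈Centre x a≢x
      ... | inj₂ (inj₂ a∈Opposite) = contradiction a∈Opposite (S∩Opposite≡∅ a (A⊆S a∈A))

    part-singleton-elim : ∀ {A B x} {P : Fin n → Set} → CompleteBipartition S A B → x ∈ A → Clique x →
                          P x → ∀ a → a ∈ A → P a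
    part-singleton-elim {P = P} S=A+B x∈A x∈Clique Px a a∈A =
      subst P (sym (part-is-singleton S=A+B x∈A x∈Clique a∈A)) Px

    clique-against-centre : ∀ {A B x} → CompleteBipartition S A B → x ∈ A → Clique x →
                            (∀ b → b ∈ B → ¬ Clique b) → ⊥
    clique-against-centre {x = x} S=A+B x∈A x∈Clique B∩Clique≡∅ =
      let y , y∈Opposite , y~Centre , y≁Clique = sees-centre-not-clique in
      no-attachment S=A+B y y∈Opposite
        (λ b b∈B → y~Centre b (non-clique⇒centre (B⊆S b∈B) (B∩Clique≡∅ b b∈B)))
        (part-singleton-elim S=A+B x∈A x∈Clique (y≁Clique x x∈Clique))
      where open CompleteBipartition S=A+B

    clique-against-clique : ∀ {A B x z} → CompleteBipartition S A B → x ∈ A → Clique x →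
                            z ∈ B → Clique z → ⊥
    clique-against-clique S=A+B x∈A x∈Clique z∈B z∈Clique
      with separating x∈Clique z∈Clique (parts-distinct S=A+B x∈A z∈B)
    ... | inj₁ (y , y∈Opposite , y~z , y≁x) =
      no-attachment S=A+B y y∈Opposite
        (part-singleton-elim (swap S=A+B) z∈B z∈Clique y~z) (part-singleton-elim S=A+B x∈A x∈Clique y≁x)
    ... | inj₂ (y , y∈Opposite , y~x , y≁z) =
      no-attachment (swap S=A+B) y y∈Opposite
        (part-singleton-elim S=A+B x∈A x∈Clique y~x) (part-singleton-elim (swap S=A+B) z∈B z∈Clique y≁z)

    part∩Clique≡∅ : ∀ {A B} → CompleteBipartition S A B → ∀ x → x ∈ A → ¬ Clique x
    part∩Clique≡∅ {B = B} S=A+B x x∈A x∈Clique with Fin.any? (λ z → (z ∈? B) ×-dec Clique? z)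
    ... | yes (z , z∈B , z∈Clique) = clique-against-clique S=A+B x∈A x∈Clique z∈B z∈Clique
    ... | no ¬B∩Clique =
      clique-against-centre S=A+B x∈A x∈Clique (λ b b∈B b∈Clique → ¬B∩Clique (b , b∈B , b∈Clique))

    two-centre-vertices : ∃₂ λ u v → u ∈ S × v ∈ S × Centre u × Centre v × u ≢ v
    two-centre-vertices with bipartition (proj₁ S-biclique)
    ... | A , B , S=A+B = a , b , A⊆S a∈A , B⊆S b∈B
                        , non-clique⇒centre (A⊆S a∈A) (part∩Clique≡∅ S=A+B a a∈A)
                        , non-clique⇒centre (B⊆S b∈B) (part∩Clique≡∅ (swap S=A+B) b b∈B)
                        , parts-distinct S=A+B a∈A b∈B
      where
      open CompleteBipartition S=A+B
      a = proj₁ A-nonempty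
      a∈A = proj₂ A-nonempty
      b = proj₁ B-nonempty
      b∈B = proj₂ B-nonempty

  universal-pair-bichromatic : ∀ {c u w} (col : Fin n → Fin c) → IsBicliqueColouring n k c col →
                               u ≢ w → Universal u → Universal w → col u ≢ col w
  universal-pair-bichromatic {u = u} {w} col col-ok u≢w u-universal w-universal same
    with col-ok _ (universal-pair-biclique u≢w u-universal w-universal)
  ... | p , q , p∈ , q∈ , col-p≢col-q = col-p≢col-q (trans (colour-of p∈) (sym (colour-of q∈)))
    where
    colour-of : ∀ {x} → x ∈ ⁅ u ⁆ ∪ ⁅ w ⁆ → col x ≡ col u
    colour-of x∈ with ∈-∪⁅⁆⁻ ⁅ u ⁆ x∈
    ... | inj₁ x∈⁅u⁆ = cong col (x∈⁅y⁆⇒x≡y u x∈⁅u⁆)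
    ... | inj₂ refl = sym same

module ThreeBlocks {a k : ℕ} (1≤a : 1 ≤ a) (a<k : a < k) where

  n : ℕ
  n = suc (a + k)

  open PathPower n k

  Low Middle High : Fin n → Set
  Low x = toℕ x < a
  Middle x = a ≤ toℕ x × toℕ x ≤ k
  High x = k < toℕ x

  toℕ≤a+k : ∀ (x : Fin n) → toℕ x ≤ a + k
  toℕ≤a+k x = s≤s⁻¹ (Fin.toℕ<n x)

  vertex : (m : ℕ) → m ≤ a + k → Fin n
  vertex m m≤a+k = fromℕ< (s≤s m≤a+k)

  toℕ-vertex : ∀ {m} (m≤a+k : m ≤ a + k) → toℕ (vertex m m≤a+k) ≡ m
  toℕ-vertex m≤a+k = Fin.toℕ-fromℕ< (s≤s m≤a+k)

  a≤k : a ≤ k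
  a≤k = <⇒≤ a<k

  m<m+k : ∀ m → m < m + k
  m<m+k m = m<m+n m (≤-trans 1≤a a≤k)

  v[a+k]-sees-middle-not-low : ∃ λ y → High y × (∀ u → Middle u → Adj y u) × (∀ x → Low x → ¬ Adj y x)
  v[a+k]-sees-middle-not-low = y , y-high , y~middle , y≁low
    where
    y = vertex (a + k) ≤-refl
    y-high : k < toℕ y
    y-high rewrite toℕ-vertex {a + k} ≤-refl = +-monoˡ-≤ k 1≤a
    y~middle : ∀ u → Middle u → Near (toℕ y) (toℕ u)
    y~middle u (a≤u , u≤k) rewrite toℕ-vertex {a + k} ≤-refl =
      near (λ eq → <⇒≱ (+-monoˡ-≤ k 1≤a) (≤-trans (≤-reflexive eq) u≤k))
           (+-monoˡ-≤ k a≤u) (≤-trans u≤k (m≤n+m k (a + k)))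
    y≁low : ∀ x → Low x → ¬ Near (toℕ y) (toℕ x)
    y≁low x x<a rewrite toℕ-vertex {a + k} ≤-refl =
      not-near (+-monoˡ-< k x<a) ∘ near-sym (a + k) (toℕ x)

  v[0]-sees-middle-not-high : ∃ λ y → Low y × (∀ u → Middle u → Adj y u) × (∀ x → High x → ¬ Adj y x)
  v[0]-sees-middle-not-high = y , y-low , y~middle , y≁high
    where
    y = vertex 0 z≤n
    y-low : toℕ y < a
    y-low rewrite toℕ-vertex {0} z≤n = 1≤a
    y~middle : ∀ u → Middle u → Near (toℕ y) (toℕ u)
    y~middle u (a≤u , u≤k) rewrite toℕ-vertex {0} z≤n =
      near (λ 0≡u → <⇒≱ 1≤a (≤-trans a≤u (≤-reflexive (sym 0≡u)))) z≤n u≤k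
    y≁high : ∀ x → High x → ¬ Near (toℕ y) (toℕ x)
    y≁high x k<x rewrite toℕ-vertex {0} z≤n = not-near k<x

  low-separates-upward : ∀ {x z} → Low x → Low z → toℕ x < toℕ z → Separates High x z
  low-separates-upward {x} {z} _ z<a x<z = y , y-high , y~z , y≁x
    where
    z+k≤a+k = +-monoˡ-≤ k (<⇒≤ z<a)
    y = vertex (toℕ z + k) z+k≤a+k
    y-high : k < toℕ y
    y-high rewrite toℕ-vertex z+k≤a+k = +-monoˡ-≤ k (≤-trans (s≤s z≤n) x<z)
    y~z : Near (toℕ y) (toℕ z)
    y~z rewrite toℕ-vertex z+k≤a+k =
      near-sym (toℕ z) (toℕ z + k)
        (near (<⇒≢ (m<m+k (toℕ z))) (≤-trans (m≤m+n (toℕ z) k) (m≤m+n _ k)) ≤-refl)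
    y≁x : ¬ Near (toℕ y) (toℕ x)
    y≁x rewrite toℕ-vertex z+k≤a+k = not-near (+-monoˡ-< k x<z) ∘ near-sym (toℕ z + k) (toℕ x)

  high-separates-downward : ∀ {x z} → High x → High z → toℕ x < toℕ z → Separates Low z x
  high-separates-downward {x} {z} k<x _ x<z = y , y-low , y~x , y≁z
    where
    x∸k≤a+k = ≤-trans (m∸n≤m (toℕ x) k) (toℕ≤a+k x)
    y = vertex (toℕ x ∸ k) x∸k≤a+k
    x∸k+k≡x : toℕ x ∸ k + k ≡ toℕ x
    x∸k+k≡x = m∸n+n≡m (<⇒≤ k<x)
    y-low : toℕ y < a
    y-low rewrite toℕ-vertex x∸k≤a+k =
      subst (toℕ x ∸ k <_) (m+n∸n≡m a k) (∸-monoˡ-< (<-≤-trans x<z (toℕ≤a+k z)) (<⇒≤ k<x))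
    y~x : Near (toℕ y) (toℕ x)
    y~x rewrite toℕ-vertex x∸k≤a+k =
      near (<⇒≢ (subst (toℕ x ∸ k <_) x∸k+k≡x (m<m+k (toℕ x ∸ k))))
           (≤-trans (m∸n≤m (toℕ x) k) (m≤m+n (toℕ x) k)) (≤-reflexive (sym x∸k+k≡x))
    y≁z : ¬ Near (toℕ y) (toℕ z)
    y≁z rewrite toℕ-vertex x∸k≤a+k = not-near (subst (_< toℕ z) (sym x∸k+k≡x) x<z)

  low⊎middle⊎high : ∀ x → Low x ⊎ Middle x ⊎ High x
  low⊎middle⊎high x with toℕ x <? a | toℕ x ≤? k
  ... | yes x<a | _ = inj₁ x<a
  ... | no x≮a | yes x≤k = inj₂ (inj₁ (≮⇒≥ x≮a , x≤k))
  ... | no _ | no x≰k = inj₂ (inj₂ (≰⇒> x≰k))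

  high⊎middle⊎low : ∀ x → High x ⊎ Middle x ⊎ Low x
  high⊎middle⊎low x = [ inj₂ ∘ inj₂ , [ inj₂ ∘ inj₁ , inj₁ ]′ ]′ (low⊎middle⊎high x)

  middle-universal : ∀ u → Middle u → Universal u
  middle-universal u (a≤u , u≤k) x u≢x =
    near (u≢x ∘ Fin.toℕ-injective)
         (≤-trans u≤k (m≤n+m k (toℕ x))) (≤-trans (toℕ≤a+k x) (+-monoˡ-≤ k a≤u))

  low-clique : ∀ x z → Low x → Low z → x ≢ z → Adj x z
  low-clique x z x<a z<a x≢z =
    near (x≢z ∘ Fin.toℕ-injective) (below-k x<a (toℕ z)) (below-k z<a (toℕ x))
    where
    below-k : ∀ {i} → i < a → ∀ j → i ≤ j + k
    below-k i<a j = ≤-trans (<⇒≤ i<a) (≤-trans a≤k (m≤n+m k j))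

  high-clique : ∀ x z → High x → High z → x ≢ z → Adj x z
  high-clique x z k<x k<z x≢z =
    near (x≢z ∘ Fin.toℕ-injective) (above-k x k<z) (above-k z k<x)
    where
    above-k : ∀ i {j} → k < toℕ j → toℕ i ≤ toℕ j + k
    above-k i k<j = ≤-trans (toℕ≤a+k i) (+-monoˡ-≤ k (<⇒≤ (<-trans a<k k<j)))

  low-separating : ∀ {x z} → Low x → Low z → x ≢ z → Separates High x z ⊎ Separates High z x
  low-separating = <-wlog low-separates-upward

  high-separating : ∀ {x z} → High x → High z → x ≢ z → Separates Low x z ⊎ Separates Low z x
  high-separating x∈High z∈High = Sum.swap ∘ <-wlog high-separates-downward x∈High z∈High

  module AvoidingHigh = CliqueAndCentre Low Middle High (λ x → toℕ x <? a) low⊎middle⊎high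
    middle-universal low-clique v[a+k]-sees-middle-not-low low-separating

  module AvoidingLow = CliqueAndCentre High Middle Low (λ x → k <? toℕ x)
    high⊎middle⊎low middle-universal high-clique v[0]-sees-middle-not-high high-separating

  Colour : Set
  Colour = Fin (suc (k ∸ a))

  -- Truncated subtraction gives all of Low the colour 0.
  colour : Fin n → Colour
  colour x = fromℕ< (s≤s (m⊓n≤n (toℕ x ∸ a) (k ∸ a)))

  toℕ-colour : ∀ x → toℕ (colour x) ≡ (toℕ x ∸ a) ⊓ (k ∸ a)
  toℕ-colour x = Fin.toℕ-fromℕ< (s≤s (m⊓n≤n (toℕ x ∸ a) (k ∸ a)))

  colour-low : ∀ x → Low x → toℕ (colour x) ≡ 0
  colour-low x x<a rewrite toℕ-colour x | m≤n⇒m∸n≡0 (<⇒≤ x<a) = refl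

  colour-high : ∀ x → High x → toℕ (colour x) ≡ k ∸ a
  colour-high x k<x rewrite toℕ-colour x = m≥n⇒m⊓n≡n (∸-monoˡ-≤ a (<⇒≤ k<x))

  colour-middle : ∀ x → Middle x → toℕ (colour x) ≡ toℕ x ∸ a
  colour-middle x (_ , x≤k) rewrite toℕ-colour x = m≤n⇒m⊓n≡m (∸-monoˡ-≤ a x≤k)

  colour-injective-on-middle : ∀ u v → Middle u → Middle v → u ≢ v → colour u ≢ colour v
  colour-injective-on-middle u v u∈M@(a≤u , _) v∈M@(a≤v , _) u≢v same =
    u≢v (Fin.toℕ-injective (∸-cancelʳ-≡ a≤u a≤v (begin
    toℕ u ∸ a          ≡⟨ sym (colour-middle u u∈M) ⟩
    toℕ (colour u)     ≡⟨ cong toℕ same ⟩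
    toℕ (colour v)     ≡⟨ colour-middle v v∈M ⟩
    toℕ v ∸ a          ∎)))
    where open ≡-Reasoning

  colour-low≢high : ∀ x y → Low x → High y → colour x ≢ colour y
  colour-low≢high x y x<a k<y same = <⇒≢ (m<n⇒0<n∸m a<k) (begin
    0               ≡⟨ sym (colour-low x x<a) ⟩
    toℕ (colour x)  ≡⟨ cong toℕ same ⟩
    toℕ (colour y)  ≡⟨ colour-high y k<y ⟩
    k ∸ a           ∎)
    where open ≡-Reasoning

  Bichromatic : Subset n → Set
  Bichromatic S = ∃₂ λ u v → u ∈ S × v ∈ S × colour u ≢ colour v

  two-middle⇒bichromatic : ∀ {S} → (∃₂ λ u v → u ∈ S × v ∈ S × Middle u × Middle v × u ≢ v) →
                           Bichromatic S
  two-middle⇒bichromatic (u , v , u∈S , v∈S , u∈M , v∈M , u≢v) =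
    u , v , u∈S , v∈S , colour-injective-on-middle u v u∈M v∈M u≢v

  colour-is-biclique-colouring : IsBicliqueColouring n k (suc (k ∸ a)) colour
  colour-is-biclique-colouring S S-biclique
    with Fin.any? (λ x → (x ∈? S) ×-dec (toℕ x <? a)) | Fin.any? (λ x → (x ∈? S) ×-dec (k <? toℕ x))
  ... | yes (x , x∈S , x<a) | yes (y , y∈S , k<y) = x , y , x∈S , y∈S , colour-low≢high x y x<a k<y
  ... | _ | no ¬S∩High =
    two-middle⇒bichromatic (AvoidingHigh.two-centre-vertices S-biclique (λ x x∈S k<x → ¬S∩High (x , x∈S , k<x)))
  ... | no ¬S∩Low | yes _ =
    two-middle⇒bichromatic (AvoidingLow.two-centre-vertices S-biclique (λ x x∈S x<a → ¬S∩Low (x , x∈S , x<a)))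

  colour≤k∸a : ∀ (j : Colour) → toℕ j ≤ k ∸ a
  colour≤k∸a j = s≤s⁻¹ (Fin.toℕ<n j)

  a+colour≤a+k : ∀ (j : Colour) → a + toℕ j ≤ a + k
  a+colour≤a+k j = +-monoʳ-≤ a (≤-trans (colour≤k∸a j) (m∸n≤m k a))

  middle-vertex : Colour → Fin n
  middle-vertex j = vertex (a + toℕ j) (a+colour≤a+k j)

  toℕ-middle-vertex : ∀ j → toℕ (middle-vertex j) ≡ a + toℕ j
  toℕ-middle-vertex j = toℕ-vertex (a+colour≤a+k j)

  middle-vertex-middle : ∀ j → Middle (middle-vertex j)
  middle-vertex-middle j rewrite toℕ-middle-vertex j =
    m≤m+n a (toℕ j) , ≤-trans (+-monoʳ-≤ a (colour≤k∸a j)) (≤-reflexive (m+[n∸m]≡n a≤k))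

  middle-vertex-injective : ∀ i j → middle-vertex i ≡ middle-vertex j → i ≡ j
  middle-vertex-injective i j same = Fin.toℕ-injective (+-cancelˡ-≡ a (toℕ i) (toℕ j) (begin
    a + toℕ i               ≡⟨ sym (toℕ-middle-vertex i) ⟩
    toℕ (middle-vertex i)   ≡⟨ cong toℕ same ⟩
    toℕ (middle-vertex j)   ≡⟨ toℕ-middle-vertex j ⟩
    a + toℕ j               ∎))
    where open ≡-Reasoning

  no-fewer-colours : ∀ m → m < suc (k ∸ a) → ¬ BicliqueColourable n k m
  no-fewer-colours m m<c (col , col-ok) with Fin.pigeonhole m<c (col ∘ middle-vertex)
  ... | i , j , i<j , same =
    universal-pair-bichromatic col col-ok (Fin.<⇒≢ i<j ∘ middle-vertex-injective i j)
      (middle-universal _ (middle-vertex-middle i)) (middle-universal _ (middle-vertex-middle j)) same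

  κ-path-power : BicliqueChromaticNumber≡ n k (suc (k ∸ a))
  κ-path-power = (colour , colour-is-biclique-colouring) , no-fewer-colours

[2k+2]∸[1+a+k]≡1+[k∸a] : ∀ {a k} → a ≤ k → (2 * k + 2) ∸ suc (a + k) ≡ suc (k ∸ a)
[2k+2]∸[1+a+k]≡1+[k∸a] {a} {k} a≤k = begin
  (2 * k + 2) ∸ suc (a + k)                  ≡⟨ cong (_∸ suc (a + k)) (sym 2k+2≡) ⟩
  (suc (k ∸ a) + suc (a + k)) ∸ suc (a + k)  ≡⟨ m+n∸n≡m (suc (k ∸ a)) (suc (a + k)) ⟩
  suc (k ∸ a)                                ∎
  where
  open ≡-Reasoning
  identity : ∀ t a → suc t + suc (a + (t + a)) ≡ 2 * (t + a) + 2
  identity = solve-∀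
  2k+2≡ : suc (k ∸ a) + suc (a + k) ≡ 2 * k + 2
  2k+2≡ = subst (λ m → suc (k ∸ a) + suc (a + m) ≡ 2 * m + 2) (m∸n+n≡m a≤k) (identity (k ∸ a) a)

theorem2 : (k n : ℕ) → 1 ≤ k → k + 2 ≤ n → n ≤ 2 * k →
    BicliqueChromaticNumber≡ n k ((2 * k + 2) ∸ n)
theorem2 k n _ k+2≤n n≤2k =
  subst (λ m → BicliqueChromaticNumber≡ m k ((2 * k + 2) ∸ m)) n≡ κ
  where
  a = n ∸ suc k
  suc-k<n : suc k < n
  suc-k<n = subst (_≤ n) (+-comm k 2) k+2≤n
  n≡ : suc (a + k) ≡ n
  n≡ = trans (sym (+-suc a k)) (m∸n+n≡m (<⇒≤ suc-k<n))
  1≤a : 1 ≤ a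
  1≤a = m<n⇒0<n∸m suc-k<n
  a<k : a < k
  a<k = +-cancelʳ-≤ k (suc a) k (subst₂ _≤_ (sym n≡) (cong (k +_) (+-identityʳ k)) n≤2k)
  κ : BicliqueChromaticNumber≡ (suc (a + k)) k ((2 * k + 2) ∸ suc (a + k))
  κ = subst (BicliqueChromaticNumber≡ _ k) (sym ([2k+2]∸[1+a+k]≡1+[k∸a] (<⇒≤ a<k)))
        (ThreeBlocks.κ-path-power 1≤a a<k)
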